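{- A sequence $a=(a_n)_{n\ge1}$ belongs to $\mathcal{A}_\infty$ if and only if there exists a family $(x^a_\lambda)_{\lambda\text{ partition}}$ of complex numbers such that for every $n\ge1$, $$a_n=\sum_{\substack{\lambda\text{ partition}\\|\lambda|\le n}}\frac{x^a_\lambda}{\binom{n}{|\lambda|}}S_{\lambda,n}.$$
   Context: For $n\ge1$ let $\rho(k)=\{2k-1,2k\}$ and let $\mathbf{P}_n$ be the set of subsets of $[2n]$ that are unions of sets $\rho(k)$, $1\le k\le n$. A partial bijection of $n$ is a triple $\alpha=(\sigma,d,d')$ with $d,d'\in\mathbf{P}_n$ and $\sigma:d\to d'$ a bijection; $Q_n$ is the set of these. Coset-type $ct(\alpha)$: take a graph with vertex set $d$, vertex $x$ having exterior label $x$ and interior label $\sigma(x)$; join by an exterior edge the vertices with exterior labels $2i-1,2i$ and by an interior edge the vertices with interior labels $2i-1,2i$; the graph is a disjoint union of cycles of lengths $2\mu_1\ge2\mu_2\ge\cdots$ and $ct(\alpha)=(\mu_1,\mu_2,\dots)$. For a partition $\lambda$ with $|\lambda|\le n$, $S_{\lambda,n}\in\mathbb{C}[Q_n]$ is the sum of all partial bijections of $n$ with coset-type $\lambda$, and $\mathcal{A}_n$ is the vector space with basis $(S_{\lambda,n})_{|\lambda|\le n}$ (a subalgebra of $\mathbb{C}[Q_n]$ for the averaged-extension product). $\varphi_n:\mathcal{A}_{n+1}\to\mathcal{A}_n$ is the linear map with $\varphi_n(S_{\lambda,n+1})=\frac{n+1}{n+1-|\lambda|}S_{\lambda,n}$ if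 $|\lambda|<n+1$ and $\varphi_n(S_{\lambda,n+1})=0$ if $|\lambda|=n+1$. $\mathcal{A}_\infty=\{(a_n)_{n\ge1}: a_n\in\mathcal{A}_n \text{ and }\varphi_n(a_{n+1})=a_n\text{ for every }n\ge1\}$. -}

module Defs where

open import Level using (Level; _⊔_) renaming (suc to lsuc)
open import Data.Nat as ℕ using (ℕ; zero; suc; _∸_; _≥_; z≤n; s≤s)
open import Data.Nat.Properties using (m≤n⇒m≤1+n)
open import Data.Nat.Combinatorics using (_C_)
open import Data.List using (List)
open import Data.Nat.ListAction using (sum)
open import Data.List.Relation.Unary.All using (All)
open import Data.List.Relation.Unary.Linked using (Linked)
open import Data.Product using (Σ; proj₁)
open import Algebra.Bundles using (CommutativeRing)
open import Relation.Nullary using (¬_)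

-- Coefficient field: a field of characteristic zero (ℂ is an instance).
-- The inverse is total; its value at 0# is unspecified.

natCast : {c ℓ : Level} (R : CommutativeRing c ℓ) → ℕ → CommutativeRing.Carrier R
natCast R zero    = CommutativeRing.0# R
natCast R (suc n) = CommutativeRing._+_ R (CommutativeRing.1# R) (natCast R n)

record CharZeroField (c ℓ : Level) : Set (lsuc (c ⊔ ℓ)) where
  field
    commutativeRing : CommutativeRing c ℓ
  open CommutativeRing commutativeRing public

  ι : ℕ → Carrier
  ι = natCast commutativeRing

  field
    _⁻¹        : Carrier → Carrier
    ⁻¹-inverse : ∀ x → ¬ (x ≈ 0#) → (x * (x ⁻¹)) ≈ 1#
    charZero   : ∀ n → ¬ (ι (suc n) ≈ 0#)

IsPartition : List ℕ → Set
IsPartition l = All (λ m → 1 ℕ.≤ m) l Data.Product.× Linked _≥_ l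

Partition : Set
Partition = Σ (List ℕ) IsPartition

size : Partition → ℕ
size μ = sum (proj₁ μ)

-- The algebra 𝒜_n, represented through its basis (S_{μ,n})_{|μ| ≤ n}:
-- an element Σ_{|μ|≤n} c_μ S_{μ,n} is the coordinate family c.

module Algebras {c ℓ : Level} (K : CharZeroField c ℓ) where
  open CharZeroField K

  𝒜 : ℕ → Set c
  𝒜 n = (μ : Partition) → size μ ℕ.≤ n → Carrier

  _≈𝒜_ : ∀ {n} → 𝒜 n → 𝒜 n → Set ℓ
  a ≈𝒜 b = ∀ μ p → a μ p ≈ b μ p

  -- φ_n : 𝒜_{n+1} → 𝒜_n,
  --   S_{μ,n+1} ↦ (n+1)/(n+1-|μ|) S_{μ,n}   if |μ| < n+1,
  --   S_{μ,n+1} ↦ 0                         if |μ| = n+1.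
  -- Coordinate of S_{μ,n} (|μ| ≤ n) in φ_n(b):
  φ : ∀ n → 𝒜 (suc n) → 𝒜 n
  φ n b μ p = (ι (suc n) * (ι (suc n ∸ size μ) ⁻¹)) * b μ (m≤n⇒m≤1+n p)

  -- 𝒜_∞ : sequences (a_n)_{n≥1} with a_n ∈ 𝒜_n and φ_n(a_{n+1}) = a_n.
  -- (A sequence is a dependent function on ℕ; the entry at index 0 is
  --  irrelevant and unconstrained.)
  Sequence : Set c
  Sequence = (n : ℕ) → 𝒜 n

  In𝒜∞ : Sequence → Set ℓ
  In𝒜∞ a = ∀ n → 1 ℕ.≤ n → φ n (a (suc n)) ≈𝒜 a n

  binomCombination : (Partition → Carrier) → (n : ℕ) → 𝒜 n
  binomCombination x n μ p = x μ * (ι (n C size μ) ⁻¹)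

-- Since (n+1-k) binom(n+1,k) = (n+1) binom(n,k), the map φ_n multiplies the
-- coordinate of S_{μ,n+1} by exactly binom(n+1,|μ|) / binom(n,|μ|).  Hence a lies
-- in 𝒜∞ iff the rescaled coordinates a_n(μ) binom(n,|μ|) do not depend on
-- n ≥ max(1,|μ|), and x_μ is their common value.
module Submission where

open import Defs
open import Level using (Level)
open import Data.Nat as ℕ
  using (ℕ; zero; suc; _∸_; _≤_; _≤′_; ≤′-refl; ≤′-step; _⊔_; _!; NonZero; s≤s; z≤n; >-nonZero)
open import Data.Nat.Properties as ℕₚ
  using ( ≤-refl; ≤-irrelevant; ≤⇒≤′; ≤′⇒≤; m≤n⇒m≤1+n; m<n⇒0<n∸m; ⊔-lub; m⊔n≤o⇒m≤o; m⊔n≤o⇒n≤o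
        ; +-∸-assoc; *-cancelʳ-≡; m*n≢0⇒m≢0; _!≢0; _!*_!≢0 )
open import Data.Nat.Combinatorics using (_C_; k![n∸k]!∣n!)
open import Data.Nat.Combinatorics.Specification using (nCk≡n!/k![n-k]!)
open import Data.Nat.DivMod using (m/n*n≡m)
open import Data.Nat.Solver using (module +-*-Solver)
open import Data.Product using (Σ; _,_)
open import Function.Bundles using (_⇔_; mk⇔; Equivalence)
open import Relation.Binary.Bundles using (Setoid)
open import Relation.Binary.PropositionalEquality as ≡ using (_≡_)
open import Relation.Nullary using (¬_)
import Algebra.Properties.Semiring.Mult as SemiringMult
import Algebra.Solver.CommutativeMonoid as CommutativeMonoidSolver
import Relation.Binary.Reasoning.Setoid as SetoidReasoning

nCk*[k!*[n∸k]!]≡n! : ∀ {n k} → k ≤ n → (n C k) ℕ.* (k ! ℕ.* (n ∸ k) !) ≡ n !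
nCk*[k!*[n∸k]!]≡n! {n} {k} k≤n = ≡.trans
  (≡.cong (ℕ._* (k ! ℕ.* (n ∸ k) !)) (nCk≡n!/k![n-k]! k≤n))
  (m/n*n≡m {{k !* (n ∸ k) !≢0}} (k![n∸k]!∣n! k≤n))

nCk≢0 : ∀ {n k} → k ≤ n → NonZero (n C k)
nCk≢0 {n} {k} k≤n =
  m*n≢0⇒m≢0 (n C k) {{≡.subst NonZero (≡.sym (nCk*[k!*[n∸k]!]≡n! k≤n)) (n !≢0)}}

-- Multiplying by k! (n ∸ k)! turns both sides into (1 + n)!.
[1+n∸k]*[1+n]Ck≡[1+n]*nCk : ∀ {n k} → k ≤ n →
  (suc n ∸ k) ℕ.* (suc n C k) ≡ suc n ℕ.* (n C k)
[1+n∸k]*[1+n]Ck≡[1+n]*nCk {n} {k} k≤n =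
  *-cancelʳ-≡ _ _ (k ! ℕ.* (n ∸ k) !) {{k !* (n ∸ k) !≢0}} (begin
    (suc n ∸ k) ℕ.* (suc n C k) ℕ.* (k ! ℕ.* (n ∸ k) !)
      ≡⟨ solve 4 (λ m c a b → m :* c :* (a :* b) := c :* (a :* (m :* b))) ≡.refl
           (suc n ∸ k) (suc n C k) (k !) ((n ∸ k) !) ⟩
    (suc n C k) ℕ.* (k ! ℕ.* ((suc n ∸ k) ℕ.* (n ∸ k) !))
      ≡⟨ ≡.cong (λ m → (suc n C k) ℕ.* (k ! ℕ.* m)) [1+n∸k]!≡[1+n∸k]*[n∸k]! ⟨
    (suc n C k) ℕ.* (k ! ℕ.* (suc n ∸ k) !)
      ≡⟨ nCk*[k!*[n∸k]!]≡n! (m≤n⇒m≤1+n k≤n) ⟩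
    suc n ℕ.* n !
      ≡⟨ ≡.cong (suc n ℕ.*_) (nCk*[k!*[n∸k]!]≡n! k≤n) ⟨
    suc n ℕ.* ((n C k) ℕ.* (k ! ℕ.* (n ∸ k) !))
      ≡⟨ ℕₚ.*-assoc (suc n) (n C k) _ ⟨
    suc n ℕ.* (n C k) ℕ.* (k ! ℕ.* (n ∸ k) !) ∎)
  where
  open ≡.≡-Reasoning
  open +-*-Solver
  [1+n∸k]!≡[1+n∸k]*[n∸k]! : (suc n ∸ k) ! ≡ (suc n ∸ k) ℕ.* (n ∸ k) !
  [1+n∸k]!≡[1+n∸k]*[n∸k]! rewrite +-∸-assoc 1 k≤n = ≡.refl

module _ {a ℓ} (S : Setoid a ℓ) where
  open Setoid S

  ≤-stable⇒constant : ∀ {s} (f : ∀ {n} → s ≤ n → Carrier) →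
    (∀ {n} (p : s ≤ n) (q : s ≤ suc n) → f q ≈ f p) →
    ∀ {n} (p : s ≤ n) → f p ≈ f ≤-refl
  ≤-stable⇒constant {s} f step p = trans (f-irrelevant p _) (from-≤′ (≤⇒≤′ p))
    where
    f-irrelevant : ∀ {n} (p q : s ≤ n) → f p ≈ f q
    f-irrelevant p q = reflexive (≡.cong f (≤-irrelevant p q))

    from-≤′ : ∀ {n} (p : s ≤′ n) → f (≤′⇒≤ p) ≈ f ≤-refl
    from-≤′ ≤′-refl      = f-irrelevant _ _
    from-≤′ (≤′-step p) = trans (step (≤′⇒≤ p) _) (from-≤′ p)

module _ {c ℓ : Level} (K : CharZeroField c ℓ) where
  open CharZeroField K
  open Algebras K
  open SemiringMult semiring using (_×_; ×1-homo-*)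
  open CommutativeMonoidSolver *-commutativeMonoid using (solve; _⊜_; _⊕_)
  open SetoidReasoning setoid

  ι≡×1# : ∀ n → ι n ≡ n × 1#
  ι≡×1# zero    = ≡.refl
  ι≡×1# (suc n) = ≡.cong (1# +_) (ι≡×1# n)

  ι-homo-* : ∀ m n → ι (m ℕ.* n) ≈ ι m * ι n
  ι-homo-* m n rewrite ι≡×1# (m ℕ.* n) | ι≡×1# m | ι≡×1# n = ×1-homo-* m n

  ι≉0 : ∀ m .{{_ : NonZero m}} → ¬ ι m ≈ 0#
  ι≉0 (suc m) = charZero m

  ι[nCk]≉0 : ∀ {n k} → k ≤ n → ¬ ι (n C k) ≈ 0#
  ι[nCk]≉0 {n} {k} k≤n = ι≉0 (n C k) {{nCk≢0 k≤n}}

  *-⁻¹-cancelʳ : ∀ {y} → ¬ y ≈ 0# → ∀ x → x * y * y ⁻¹ ≈ x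
  *-⁻¹-cancelʳ {y} y≉0 x = begin
    x * y * y ⁻¹   ≈⟨ *-assoc x y (y ⁻¹) ⟩
    x * (y * y ⁻¹) ≈⟨ *-congˡ (⁻¹-inverse y y≉0) ⟩
    x * 1#         ≈⟨ *-identityʳ x ⟩
    x              ∎

  ⁻¹-*-cancelʳ : ∀ {y} → ¬ y ≈ 0# → ∀ x → x * y ⁻¹ * y ≈ x
  ⁻¹-*-cancelʳ {y} y≉0 x = begin
    x * y ⁻¹ * y ≈⟨ solve 3 (λ x y y′ → (x ⊕ y′) ⊕ y ⊜ (x ⊕ y) ⊕ y′) refl x y (y ⁻¹) ⟩
    x * y * y ⁻¹ ≈⟨ *-⁻¹-cancelʳ y≉0 x ⟩
    x            ∎

  *-cancelʳ-≉0 : ∀ {x y z} → ¬ z ≈ 0# → x * z ≈ y * z → x ≈ y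
  *-cancelʳ-≉0 {x} {y} {z} z≉0 xz≈yz = begin
    x             ≈⟨ *-⁻¹-cancelʳ z≉0 x ⟨
    x * z * z ⁻¹  ≈⟨ *-congʳ xz≈yz ⟩
    y * z * z ⁻¹  ≈⟨ *-⁻¹-cancelʳ z≉0 y ⟩
    y             ∎

  -- Coordinates with respect to the basis S_{μ,n} / binom(n,|μ|).
  binomScale : ∀ {n} → 𝒜 n → 𝒜 n
  binomScale {n} b μ p = b μ p * ι (n C size μ)

  binomScale-irrelevant : ∀ {n} (b : 𝒜 n) μ (p q : size μ ≤ n) →
    binomScale b μ p ≈ binomScale b μ q
  binomScale-irrelevant b μ p q = reflexive (≡.cong (binomScale b μ) (≤-irrelevant p q))

  binomScale-cancel : ∀ {n} (b b′ : 𝒜 n) μ p →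
    binomScale b μ p ≈ binomScale b′ μ p → b μ p ≈ b′ μ p
  binomScale-cancel b b′ μ p = *-cancelʳ-≉0 (ι[nCk]≉0 p)

  φ-binomScale : ∀ n (b : 𝒜 (suc n)) μ (p : size μ ≤ n) →
    binomScale (φ n b) μ p ≈ binomScale b μ (m≤n⇒m≤1+n p)
  φ-binomScale n b μ p = begin
    A * B ⁻¹ * β * Cₙ
      ≈⟨ solve 4 (λ A B′ β Cₙ → ((A ⊕ B′) ⊕ β) ⊕ Cₙ ⊜ (β ⊕ (A ⊕ Cₙ)) ⊕ B′) refl A (B ⁻¹) β Cₙ ⟩
    β * (A * Cₙ) * B ⁻¹
      ≈⟨ *-congʳ (*-congˡ B*Cₙ₊₁≈A*Cₙ) ⟨
    β * (B * Cₙ₊₁) * B ⁻¹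
      ≈⟨ *-congʳ (solve 3 (λ β B Cₙ₊₁ → β ⊕ (B ⊕ Cₙ₊₁) ⊜ (β ⊕ Cₙ₊₁) ⊕ B) refl β B Cₙ₊₁) ⟩
    β * Cₙ₊₁ * B * B ⁻¹
      ≈⟨ *-⁻¹-cancelʳ B≉0 (β * Cₙ₊₁) ⟩
    β * Cₙ₊₁ ∎
    where
    k : ℕ
    k = size μ

    β A B Cₙ Cₙ₊₁ : Carrier
    β    = b μ (m≤n⇒m≤1+n p)
    A    = ι (suc n)
    B    = ι (suc n ∸ k)
    Cₙ   = ι (n C k)
    Cₙ₊₁ = ι (suc n C k)

    B≉0 : ¬ B ≈ 0#
    B≉0 = ι≉0 (suc n ∸ k) {{>-nonZero (m<n⇒0<n∸m (s≤s p))}}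

    B*Cₙ₊₁≈A*Cₙ : B * Cₙ₊₁ ≈ A * Cₙ
    B*Cₙ₊₁≈A*Cₙ = begin
      B * Cₙ₊₁                         ≈⟨ ι-homo-* (suc n ∸ k) (suc n C k) ⟨
      ι ((suc n ∸ k) ℕ.* (suc n C k))  ≡⟨ ≡.cong ι ([1+n∸k]*[1+n]Ck≡[1+n]*nCk p) ⟩
      ι (suc n ℕ.* (n C k))            ≈⟨ ι-homo-* (suc n) (n C k) ⟩
      A * Cₙ                           ∎

  ≈binomCombination⇔binomScale≈ : ∀ {n} (b : 𝒜 n) (x : Partition → Carrier) →
    b ≈𝒜 binomCombination x n ⇔ (∀ μ p → binomScale b μ p ≈ x μ)
  ≈binomCombination⇔binomScale≈ {n} b x = mk⇔
    (λ b≈ μ p → trans (*-congʳ (b≈ μ p)) (⁻¹-*-cancelʳ (ι[nCk]≉0 p) (x μ)))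
    (λ scaled≈ μ p → binomScale-cancel b (binomCombination x n) μ p
      (trans (scaled≈ μ p) (sym (⁻¹-*-cancelʳ (ι[nCk]≉0 p) (x μ)))))

  BinomScaleStable : Sequence → Set ℓ
  BinomScaleStable a = ∀ n → 1 ≤ n → ∀ μ (p : size μ ≤ n) (q : size μ ≤ suc n) →
    binomScale (a (suc n)) μ q ≈ binomScale (a n) μ p

  In𝒜∞⇒binomScale-stable : ∀ {a} → In𝒜∞ a → BinomScaleStable a
  In𝒜∞⇒binomScale-stable {a} a∈𝒜∞ n 1≤n μ p q = begin
    binomScale (a (suc n)) μ q                ≈⟨ binomScale-irrelevant (a (suc n)) μ q _ ⟩
    binomScale (a (suc n)) μ (m≤n⇒m≤1+n p)    ≈⟨ φ-binomScale n (a (suc n)) μ p ⟨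
    binomScale (φ n (a (suc n))) μ p          ≈⟨ *-congʳ (a∈𝒜∞ n 1≤n μ p) ⟩
    binomScale (a n) μ p                      ∎

  binomScale-stable⇒In𝒜∞ : ∀ {a} → BinomScaleStable a → In𝒜∞ a
  binomScale-stable⇒In𝒜∞ {a} stable n 1≤n μ p =
    binomScale-cancel (φ n (a (suc n))) (a n) μ p (begin
      binomScale (φ n (a (suc n))) μ p         ≈⟨ φ-binomScale n (a (suc n)) μ p ⟩
      binomScale (a (suc n)) μ (m≤n⇒m≤1+n p)   ≈⟨ stable n 1≤n μ p _ ⟩
      binomScale (a n) μ p                     ∎)

  BinomScaleConstant : Sequence → (Partition → Carrier) → Set ℓ
  BinomScaleConstant a x = ∀ n → 1 ≤ n → ∀ μ p → binomScale (a n) μ p ≈ x μ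

  binomScale-stable⇒constant : ∀ {a} → BinomScaleStable a →
    Σ (Partition → Carrier) (BinomScaleConstant a)
  binomScale-stable⇒constant {a} stable = x , constant
    where
    f : ∀ μ {n} → 1 ⊔ size μ ≤ n → Carrier
    f μ q = binomScale (a _) μ (m⊔n≤o⇒n≤o 1 (size μ) q)

    x : Partition → Carrier
    x μ = f μ ≤-refl

    constant : BinomScaleConstant a x
    constant n 1≤n μ p = trans
      (binomScale-irrelevant (a n) μ p _)
      (≤-stable⇒constant setoid (f μ)
        (λ q _ → stable _ (m⊔n≤o⇒m≤o 1 (size μ) q) μ _ _)
        (⊔-lub 1≤n p))

  binomScale-constant⇒stable : ∀ {a x} → BinomScaleConstant a x → BinomScaleStable a
  binomScale-constant⇒stable constant n 1≤n μ p q =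
    trans (constant (suc n) (s≤s z≤n) μ q) (sym (constant n 1≤n μ p))

  In𝒜∞⇒binomCombination : ∀ {a} → In𝒜∞ a →
    Σ (Partition → Carrier) (λ x → ∀ n → 1 ≤ n → a n ≈𝒜 binomCombination x n)
  In𝒜∞⇒binomCombination {a} a∈𝒜∞
    with x , constant ← binomScale-stable⇒constant (In𝒜∞⇒binomScale-stable a∈𝒜∞)
    = x , λ n 1≤n → Equivalence.from (≈binomCombination⇔binomScale≈ (a n) x) (constant n 1≤n)

  binomCombination⇒In𝒜∞ : ∀ {a} →
    Σ (Partition → Carrier) (λ x → ∀ n → 1 ≤ n → a n ≈𝒜 binomCombination x n) → In𝒜∞ a
  binomCombination⇒In𝒜∞ {a} (x , a≈) = binomScale-stable⇒In𝒜∞ (binomScale-constant⇒stable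
    (λ n 1≤n → Equivalence.to (≈binomCombination⇔binomScale≈ (a n) x) (a≈ n 1≤n)))

lemma3p7 : {c ℓ : Level} (K : CharZeroField c ℓ) →
    let open CharZeroField K
        open Algebras K
    in (a : Sequence) →
       In𝒜∞ a ⇔ Σ (Partition → Carrier)
                  (λ x → (n : ℕ) → 1 ≤ n → a n ≈𝒜 binomCombination x n)
lemma3p7 K a = mk⇔ (In𝒜∞⇒binomCombination K) (binomCombination⇒In𝒜∞ K)
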